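{- The axiomatization $\mathbf{SML}$ is sound for $\mathcal{L}^{\Box\rightrightarrows}$: every formula of $\mathcal{L}^{\Box\rightrightarrows}$ derivable in $\mathbf{SML}$ is valid.
   Context: Fix a non-empty countable set $P$ of atoms and a non-empty finite set $A$ of agents. $\mathcal{L}^{\Box\rightrightarrows}$: $\varphi ::= p \mid \neg\varphi \mid (\varphi\wedge\varphi) \mid \Box_a\varphi \mid [\rightrightarrows]\varphi$; $\mathcal{L}^\Box$ is the fragment without $[\rightrightarrows]$, $\mathcal{L}_0$ the propositional fragment. Abbreviations: usual Boolean connectives, $\Diamond_a\varphi:=\neg\Box_a\neg\varphi$, $\langle\rightrightarrows\rangle\varphi:=\neg[\rightrightarrows]\neg\varphi$, and for finite $\Phi$, $\nabla_a\Phi:=\bigwedge_{\varphi\in\Phi}\Diamond_a\varphi\wedge\Box_a\bigvee_{\varphi\in\Phi}\varphi$. A model is $M=(S,R,V)$ with $S$ non-empty countable, $R_a\subseteq S\times S$, $V:S\to\mathcal{P}(P)$. For models $M,M'$, a non-empty $Z\subseteq S\times S'$ is a simulation if for all $(s,s')\in Z$, $a\in A$: $V(s)=V'(s')$, and if $(s,t)\in R_a$ then there is $t'$ with $(s',t')\in R'_a$ and $(t,t')\in Z$. $M_s\rightrightarrows M'_{s'}$: some simulation contains $(s,s')$. Semantics: $M_s\models p$ iff $p\in V(s)$; Boolean clauses as usual; $M_s\models\Box_a\varphi$ iff $M_t\models\varphi$ for all $(s,t)\in R_a$; $M_s\models[\rightrightarrows]\varphi$ iff $M'_{s'}\models\varphi$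 for all $M'_{s'}$ with $M_s\rightrightarrows M'_{s'}$. Valid: true at every pointed model. $\mathbf{SML}$ consists of the following over $\mathcal{L}^{\Box\rightrightarrows}$: Prop (substitution instances of tautologies); K: $\Box_a(\varphi\to\psi)\to(\Box_a\varphi\to\Box_a\psi)$; MP; N: from $\varphi$ infer $\Box_a\varphi$; RE: from $\chi\leftrightarrow\psi$ infer $\varphi[\chi/p]\leftrightarrow\varphi[\psi/p]$; SQ1: $\langle\rightrightarrows\rangle\varphi_0\leftrightarrow\varphi_0$ ($\varphi_0\in\mathcal{L}_0$); SQ2: $\langle\rightrightarrows\rangle(\varphi\vee\psi)\leftrightarrow(\langle\rightrightarrows\rangle\varphi\vee\langle\rightrightarrows\rangle\psi)$; SQ3: $\langle\rightrightarrows\rangle(\varphi_0\wedge\varphi)\leftrightarrow(\varphi_0\wedge\langle\rightrightarrows\rangle\varphi)$ ($\varphi_0\in\mathcal{L}_0$); SQ4$_{\mathsf{cons}}$: $\langle\rightrightarrows\rangle\bigwedge_{a\in A}\nabla_a\Phi_a\leftrightarrow\bigwedge_{a\in A}\Box_a\bigvee_{\varphi\in\Phi_a}\langle\rightrightarrows\rangle\varphi$, for finite sets $\Phi_a$ all of whose elements $\varphi$ are consistent $\mathcal{L}^\Box$ formulas (consistent in basic multi-modal logic K, i.e. satisfiable). -}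

module Defs where

open import Level using (Level; 0ℓ) renaming (suc to lsuc)
open import Data.Nat as ℕ using (ℕ; suc)
open import Data.Fin using (Fin)
open import Data.Bool using (Bool; true; false; not; if_then_else_) renaming (_∧_ to _&&_)
open import Data.List using (List; []; _∷_; map; allFin)
open import Data.List.Relation.Unary.All using (All)
open import Data.Product using (Σ; _×_; _,_)
open import Data.Empty using (⊥)
open import Relation.Nullary using (¬_; Dec; yes; no)
open import Relation.Binary.PropositionalEquality using (_≡_; cong)
open import Relation.Binary.Definitions using (DecidableEquality)
open import Function.Definitions using (Injective)

-- The logic is parametrised by:
--   n         : the set of agents A is Fin (suc n)  (non-empty, finite)
--   Atom      : the set of atoms P, with
--   a₀        : an atom (P non-empty), and
--   code/inj  : an injection P → ℕ (P countable)
module Logic (n : ℕ) (Atom : Set) (a₀ : Atom)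
             (code : Atom → ℕ) (code-inj : Injective _≡_ _≡_ code) where

  Agent : Set
  Agent = Fin (suc n)

  _≟ₐ_ : DecidableEquality Atom
  x ≟ₐ y with code x ℕ.≟ code y
  ... | yes e = yes (code-inj e)
  ... | no ne = no (λ e → ne (cong code e))

  infixr 6 _∧_
  data Form : Set where
    atom : Atom → Form
    ~_   : Form → Form
    _∧_  : Form → Form → Form
    □    : Agent → Form → Form
    [⇉]  : Form → Form

  data InLBox : Form → Set where
    atom : ∀ p → InLBox (atom p)
    ~_   : ∀ {φ} → InLBox φ → InLBox (~ φ)
    _∧_  : ∀ {φ ψ} → InLBox φ → InLBox ψ → InLBox (φ ∧ ψ)
    □    : ∀ a {φ} → InLBox φ → InLBox (□ a φ)

  infixr 5 _∨_
  infixr 4 _⇒_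
  infix 3 _⇔_
  _∨_ : Form → Form → Form
  φ ∨ ψ = ~ (~ φ ∧ ~ ψ)

  _⇒_ : Form → Form → Form
  φ ⇒ ψ = ~ (φ ∧ ~ ψ)

  _⇔_ : Form → Form → Form
  φ ⇔ ψ = (φ ⇒ ψ) ∧ (ψ ⇒ φ)

  ⊤f : Form
  ⊤f = ~ (atom a₀ ∧ ~ atom a₀)

  ⊥f : Form
  ⊥f = ~ ⊤f

  ◇ : Agent → Form → Form
  ◇ a φ = ~ □ a (~ φ)

  ⟨⇉⟩ : Form → Form
  ⟨⇉⟩ φ = ~ [⇉] (~ φ)

  -- finite conjunctions / disjunctions (finite sets given as lists)
  ⋀ : List Form → Form
  ⋀ []      = ⊤f
  ⋀ (φ ∷ Φ) = φ ∧ ⋀ Φ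

  ⋁ : List Form → Form
  ⋁ []      = ⊥f
  ⋁ (φ ∷ Φ) = φ ∨ ⋁ Φ

  ⋀A : (Agent → Form) → Form
  ⋀A f = ⋀ (map f (allFin (suc n)))

  ∇ : Agent → List Form → Form
  ∇ a Φ = ⋀ (map (◇ a) Φ) ∧ □ a (⋁ Φ)

  _[_/_] : Form → Form → Atom → Form
  atom q  [ χ / p ] with p ≟ₐ q
  ... | yes _ = χ
  ... | no  _ = atom q
  (~ φ)   [ χ / p ] = ~ (φ [ χ / p ])
  (φ ∧ ψ) [ χ / p ] = (φ [ χ / p ]) ∧ (ψ [ χ / p ])
  □ a φ   [ χ / p ] = □ a (φ [ χ / p ])
  [⇉] φ   [ χ / p ] = [⇉] (φ [ χ / p ])

  data PF : Set where
    var  : Atom → PF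
    neg  : PF → PF
    conj : PF → PF → PF

  ⌜_⌝ : PF → Form
  ⌜ var p ⌝    = atom p
  ⌜ neg ψ ⌝    = ~ ⌜ ψ ⌝
  ⌜ conj ψ χ ⌝ = ⌜ ψ ⌝ ∧ ⌜ χ ⌝

  evalPF : (Atom → Bool) → PF → Bool
  evalPF v (var p)    = v p
  evalPF v (neg ψ)    = not (evalPF v ψ)
  evalPF v (conj ψ χ) = evalPF v ψ && evalPF v χ

  Tautology : PF → Set
  Tautology ψ = ∀ (v : Atom → Bool) → evalPF v ψ ≡ true

  substPF : (Atom → Form) → PF → Form
  substPF σ (var p)    = σ p
  substPF σ (neg ψ)    = ~ substPF σ ψ
  substPF σ (conj ψ χ) = substPF σ ψ ∧ substPF σ χ

  -- Models: non-empty countable domain, relations R_a, valuation V(s) ⊆ P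
  -- (V(s) given by its characteristic function)

  record Model : Set₁ where
    field
      S     : Set
      s₀    : S                          -- S non-empty
      enc   : S → ℕ                      -- S countable
      enc-inj : Injective _≡_ _≡_ enc
      R     : Agent → S → S → Set
      V     : S → Atom → Bool
  open Model public

  record IsSimulation (M M' : Model) (Z : S M → S M' → Set) : Set where
    field
      atoms : ∀ s s' → Z s s' → ∀ p → V M s p ≡ V M' s' p
      forth : ∀ s s' → Z s s' → ∀ a t → R M a s t →
              Σ (S M') λ t' → R M' a s' t' × Z t t'

  _,_⇉_,_ : (M : Model) → S M → (M' : Model) → S M' → Set₁
  M , s ⇉ M' , s' =
    Σ (S M → S M' → Set) λ Z → IsSimulation M M' Z × Z s s'

  Sat : (M : Model) → S M → Form → Set₁
  Sat M s (atom p) = Level.Lift _ (V M s p ≡ true)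
  Sat M s (~ φ)    = ¬ Sat M s φ
  Sat M s (φ ∧ ψ)  = Sat M s φ × Sat M s ψ
  Sat M s (□ a φ)  = ∀ t → R M a s t → Sat M t φ
  Sat M s ([⇉] φ)  = ∀ (M' : Model) (s' : S M') → M , s ⇉ M' , s' → Sat M' s' φ

  Valid : Form → Set₁
  Valid φ = ∀ (M : Model) (s : S M) → Sat M s φ

  -- consistency of an L^□ formula in K, i.e. satisfiability
  Consistent : Form → Set₁
  Consistent φ = Σ Model λ M → Σ (S M) λ s → Sat M s φ

  infix 2 ⊢_
  data ⊢_ : Form → Set₁ where
    Prop : ∀ (ψ : PF) (σ : Atom → Form) → Tautology ψ → ⊢ substPF σ ψ
    K    : ∀ a φ ψ → ⊢ (□ a (φ ⇒ ψ) ⇒ (□ a φ ⇒ □ a ψ))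
    MP   : ∀ {φ ψ} → ⊢ (φ ⇒ ψ) → ⊢ φ → ⊢ ψ
    N    : ∀ a {φ} → ⊢ φ → ⊢ □ a φ
    RE   : ∀ {χ ψ} (φ : Form) (p : Atom) → ⊢ (χ ⇔ ψ) →
           ⊢ ((φ [ χ / p ]) ⇔ (φ [ ψ / p ]))
    SQ1  : ∀ (φ₀ : PF) → ⊢ (⟨⇉⟩ ⌜ φ₀ ⌝ ⇔ ⌜ φ₀ ⌝)
    SQ2  : ∀ φ ψ → ⊢ (⟨⇉⟩ (φ ∨ ψ) ⇔ (⟨⇉⟩ φ ∨ ⟨⇉⟩ ψ))
    SQ3  : ∀ (φ₀ : PF) φ → ⊢ (⟨⇉⟩ (⌜ φ₀ ⌝ ∧ φ) ⇔ (⌜ φ₀ ⌝ ∧ ⟨⇉⟩ φ))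
    SQ4cons : ∀ (Φ : Agent → List Form) →
           (∀ a → All (λ φ → InLBox φ × Consistent φ) (Φ a)) →
           ⊢ (⟨⇉⟩ (⋀A (λ a → ∇ a (Φ a)))
               ⇔ ⋀A (λ a → □ a (⋁ (map ⟨⇉⟩ (Φ a)))))

{-# OPTIONS --safe #-}
module Submission where

-- Every rule is checked semantically, reading the connectives classically (hence the
-- excluded-middle hypothesis). ⟨⇉⟩ is an existential quantifier over simulating pointed
-- models, so it distributes over ∨ (SQ2); simulations preserve atoms and the identity is a
-- simulation (SQ1, SQ3); and the forth condition gives the left-to-right half of SQ4.
-- For the right-to-left half, suppose every a-successor t of s satisfies ⟨⇉⟩φ for some
-- φ ∈ Φ_a. Choose for each such t a pointed model simulating t in which ⋁Φ_a holds, and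
-- for each φ ∈ Φ_a a model of φ (φ is consistent). A fresh root r with the atoms of s,
-- whose a-successors are the roots of these pieces, satisfies M_s ⇉ M′_r; each piece is a
-- generated submodel and the Φ_a lie in L^□, so r satisfies every ∇_a Φ_a. The new domain
-- is countable by Cantor pairing.

open import Axiom.DoubleNegationElimination using (em⇒dne)
open import Axiom.ExcludedMiddle using (ExcludedMiddle)
open import Data.Bool using (Bool; true; false; not; T)
open import Data.Bool.Properties using (T-∧; T-≡)
open import Data.Empty using (⊥; ⊥-elim)
open import Data.Fin using (Fin)
open import Data.Fin.Properties using (toℕ-injective)
open import Data.List using (List; []; _∷_; map; lookup; length)
open import Data.List.Membership.Propositional using (find; lose)
open import Data.List.Membership.Propositional.Properties using (∈-allFin; ∈-lookup)
open import Data.List.Relation.Unary.All as All using (All; []; _∷_)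
import Data.List.Relation.Unary.All.Properties as Allₚ
open import Data.List.Relation.Unary.Any as Any using (Any; here; there)
import Data.List.Relation.Unary.Any.Properties as Anyₚ
open import Data.Nat using (ℕ; zero; suc; _+_; _≤_; _<_; z≤n; s≤s)
open import Data.Nat.Properties
  using ( ≤-refl; ≤-trans; <-irrefl; <-cmp; m≤m+n; +-monoʳ-<; +-cancelˡ-≡; m≤n⇒m<n∨m≡n
        ; module ≤-Reasoning )
open import Data.Product using (Σ; _×_; _,_; proj₁; proj₂)
open import Data.Product.Function.NonDependent.Propositional using (_×-⇔_)
open import Data.Sum as Sum using (_⊎_; inj₁; inj₂; [_,_]; [_,_]′)
open import Data.Sum.Function.Propositional using (_⊎-⇔_)
open import Data.Unit using (⊤; tt)
open import Defs
open import Function.Base using (_∘_)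
open import Function.Bundles using (Injection; _↣_; mk↣; Equivalence; mk⇔) renaming (_⇔_ to _⟺_)
open import Function.Construct.Composition using (_⇔-∘_)
open import Function.Construct.Identity using (⇔-id)
open import Function.Construct.Symmetry using (⇔-sym)
open import Function.Definitions using (Injective)
open import Function.Related.Propositional using (equivalence; module EquationalReasoning)
open import Function.Related.TypeIsomorphisms using (¬-cong-⇔)
open import Level using (0ℓ; Lift; lift) renaming (suc to lsuc)
open import Relation.Binary.Definitions using (tri<; tri≈; tri>)
open import Relation.Binary.PropositionalEquality using (_≡_; refl; sym; trans; cong; subst)
open import Relation.Nullary using (¬_; yes; no)
open import Relation.Nullary.Decidable using (isYes; toWitness; fromWitness)

triangle : ℕ → ℕ
triangle zero    = 0
triangle (suc d) = triangle d + suc d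

triangle-mono-≤ : ∀ {m n} → m ≤ n → triangle m ≤ triangle n
triangle-mono-≤ {n = zero}  z≤n = ≤-refl
triangle-mono-≤ {n = suc n} m≤1+n with m≤n⇒m<n∨m≡n m≤1+n
... | inj₁ (s≤s m≤n) = ≤-trans (triangle-mono-≤ m≤n) (m≤m+n (triangle n) (suc n))
... | inj₂ refl      = ≤-refl

cantor : ℕ → ℕ → ℕ
cantor a b = triangle (a + b) + a

cantor-<-diagonal : ∀ a b c d → a + b < c + d → cantor a b < cantor c d
cantor-<-diagonal a b c d a+b<c+d = begin-strict
  triangle (a + b) + a    <⟨ +-monoʳ-< (triangle (a + b)) (s≤s (m≤m+n a b)) ⟩
  triangle (suc (a + b))  ≤⟨ triangle-mono-≤ a+b<c+d ⟩
  triangle (c + d)        ≤⟨ m≤m+n (triangle (c + d)) c ⟩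
  cantor c d              ∎
  where open ≤-Reasoning

cantor-injective : ∀ a b c d → cantor a b ≡ cantor c d → a ≡ c × b ≡ d
cantor-injective a b c d eq with <-cmp (a + b) (c + d)
... | tri< lt _ _   = ⊥-elim (<-irrefl eq (cantor-<-diagonal a b c d lt))
... | tri> _ _ gt   = ⊥-elim (<-irrefl (sym eq) (cantor-<-diagonal c d a b gt))
... | tri≈ _ same _ = a≡c , +-cancelˡ-≡ a b d (trans same (cong (_+ d) (sym a≡c)))
  where
  a≡c : a ≡ c
  a≡c = +-cancelˡ-≡ (triangle (a + b)) a c (trans eq (cong (λ k → triangle k + c) (sym same)))

Countable : Set → Set
Countable A = A ↣ ℕ

countable-⊤ : Countable ⊤
countable-⊤ = mk↣ {to = λ _ → 0} (λ _ → refl)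

countable-Fin : ∀ {k} → Countable (Fin k)
countable-Fin = mk↣ toℕ-injective

countable-⊎ : ∀ {A B} → Countable A → Countable B → Countable (A ⊎ B)
countable-⊎ {A} {B} cA cB = mk↣ injective
  where
  open Injection cA using () renaming (to to codeA; injective to codeA-injective)
  open Injection cB using () renaming (to to codeB; injective to codeB-injective)

  code : A ⊎ B → ℕ
  code = [ cantor 0 ∘ codeA , cantor 1 ∘ codeB ]′

  injective : Injective _≡_ _≡_ code
  injective {inj₁ x} {inj₁ y} eq =
    cong inj₁ (codeA-injective (proj₂ (cantor-injective 0 (codeA x) 0 (codeA y) eq)))
  injective {inj₂ x} {inj₂ y} eq =
    cong inj₂ (codeB-injective (proj₂ (cantor-injective 1 (codeB x) 1 (codeB y) eq)))
  injective {inj₁ x} {inj₂ y} eq with () ← proj₁ (cantor-injective 0 (codeA x) 1 (codeB y) eq)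
  injective {inj₂ x} {inj₁ y} eq with () ← proj₁ (cantor-injective 1 (codeB x) 0 (codeA y) eq)

countable-Σ : ∀ {A} {B : A → Set} → Countable A → (∀ x → Countable (B x)) → Countable (Σ A B)
countable-Σ {A} {B} cA cB = mk↣ injective
  where
  open Injection cA using () renaming (to to codeA; injective to codeA-injective)

  code : Σ A B → ℕ
  code (x , y) = cantor (codeA x) (Injection.to (cB x) y)

  injective : Injective _≡_ _≡_ code
  injective {x , y} {x′ , y′} eq with cantor-injective _ _ _ _ eq
  ... | x≡x′ , y≡y′ with refl ← codeA-injective x≡x′
                    with refl ← Injection.injective (cB x) y≡y′ = refl

T-not : ∀ b → T (not b) ⟺ (¬ T b)
T-not true  = mk⇔ (λ ()) (λ ¬t → ¬t tt)
T-not false = mk⇔ (λ _ ()) (λ _ → tt)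

module Soundness (n : ℕ) (Atom : Set) (a₀ : Atom) (code : Atom → ℕ)
                 (code-inj : Injective _≡_ _≡_ code) where
  open Logic n Atom a₀ code code-inj
  open Equivalence using (to; from)

  countable-S : (M : Model) → Countable (S M)
  countable-S M = mk↣ (enc-inj M)

  ⟨⇉⟩Sat : (M : Model) → S M → Form → Set₁
  ⟨⇉⟩Sat M s φ = Σ Model λ M′ → Σ (S M′) λ s′ → (M , s ⇉ M′ , s′) × Sat M′ s′ φ

  ⇉-refl : ∀ {M s} → M , s ⇉ M , s
  ⇉-refl = _≡_ , isSimulation , refl
    where
    isSimulation : IsSimulation _ _ _≡_
    isSimulation = record
      { atoms = λ { _ _ refl _ → refl }
      ; forth = λ { _ _ refl _ t r → t , r , refl }
      }

  ⇉-atoms : ∀ {M M′ s s′} → M , s ⇉ M′ , s′ → ∀ p → V M s p ≡ V M′ s′ p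
  ⇉-atoms (_ , sim , sZs′) = IsSimulation.atoms sim _ _ sZs′

  ⇉-forth : ∀ {M M′ s s′ a t} → M , s ⇉ M′ , s′ → R M a s t →
            Σ (S M′) λ t′ → R M′ a s′ t′ × (M , t ⇉ M′ , t′)
  ⇉-forth (Z , sim , sZs′) r with IsSimulation.forth sim _ _ sZs′ _ _ r
  ... | t′ , r′ , tZt′ = t′ , r′ , (Z , sim , tZt′)

  ∅-isSimulation : ∀ {M M′} → IsSimulation M M′ (λ _ _ → ⊥)
  ∅-isSimulation = record { atoms = λ _ _ () ; forth = λ _ _ () }

  sat-⊤f : ∀ {M s} → Sat M s ⊤f
  sat-⊤f (x , ¬x) = ¬x x

  sat-⋀ : ∀ {M s} Φ → Sat M s (⋀ Φ) ⟺ All (Sat M s) Φ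
  sat-⋀ {M} {s} [] = mk⇔ (λ _ → []) (λ _ → sat-⊤f {M} {s})
  sat-⋀ (φ ∷ Φ)    = mk⇔ (λ (x , xs) → x ∷ to (sat-⋀ Φ) xs) (λ { (x ∷ xs) → x , from (sat-⋀ Φ) xs })

  sat-⋀A : ∀ {M s} f → Sat M s (⋀A f) ⟺ (∀ a → Sat M s (f a))
  sat-⋀A f = mk⇔ (λ h a → All.lookup (Allₚ.map⁻ (to (sat-⋀ _) h)) (∈-allFin a))
                 (λ h → from (sat-⋀ _) (Allₚ.map⁺ (All.tabulate (λ {a} _ → h a))))

  ⋁-intro : ∀ {M s Φ} → Any (Sat M s) Φ → Sat M s (⋁ Φ)
  ⋁-intro (here x)   (¬x , _)  = ¬x x
  ⋁-intro (there xs) (_ , ¬xs) = ¬xs (⋁-intro xs)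

  ◇-intro : ∀ {M s a t φ} → R M a s t → Sat M t φ → Sat M s (◇ a φ)
  ◇-intro r x □¬ = □¬ _ r x

  InLBox-⋁ : ∀ {Φ} → All InLBox Φ → InLBox (⋁ Φ)
  InLBox-⋁ []       = ~ (~ (atom a₀ ∧ ~ atom a₀))
  InLBox-⋁ (b ∷ bs) = ~ (~ b ∧ ~ InLBox-⋁ bs)

  sat-atom-cong : ∀ M s M′ s′ {p} → V M s p ≡ V M′ s′ p → Sat M s (atom p) ⟺ Sat M′ s′ (atom p)
  sat-atom-cong _ _ _ _ eq =
    mk⇔ (λ (lift x) → lift (trans (sym eq) x)) (λ (lift x) → lift (trans eq x))

  sat-⌜⌝-cong : ∀ {M M′ s s′} → (∀ p → V M s p ≡ V M′ s′ p) →
                ∀ φ₀ → Sat M s ⌜ φ₀ ⌝ ⟺ Sat M′ s′ ⌜ φ₀ ⌝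
  sat-⌜⌝-cong {M} {M′} {s} {s′} same (var p) = sat-atom-cong M s M′ s′ (same p)
  sat-⌜⌝-cong same (neg ψ)    = ¬-cong-⇔ (sat-⌜⌝-cong same ψ)
  sat-⌜⌝-cong same (conj ψ χ) = sat-⌜⌝-cong same ψ ×-⇔ sat-⌜⌝-cong same χ

  record IsBoundedMorphism (M M′ : Model) (f : S M → S M′) : Set where
    field
      atoms : ∀ s p → V M s p ≡ V M′ (f s) p
      forth : ∀ {a s t} → R M a s t → R M′ a (f s) (f t)
      back  : ∀ {a s u} → R M′ a (f s) u → Σ (S M) λ t → R M a s t × f t ≡ u

  sat-boundedMorphism : ∀ {M M′ f} → IsBoundedMorphism M M′ f →
                        ∀ {φ} → InLBox φ → ∀ s → Sat M s φ ⟺ Sat M′ (f s) φ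
  sat-boundedMorphism {M} {M′} {f} hom (atom p) s =
    sat-atom-cong M s M′ (f s) (IsBoundedMorphism.atoms hom s p)
  sat-boundedMorphism hom (~ b)   s = ¬-cong-⇔ (sat-boundedMorphism hom b s)
  sat-boundedMorphism hom (b ∧ c) s = sat-boundedMorphism hom b s ×-⇔ sat-boundedMorphism hom c s
  sat-boundedMorphism {M} {M′} {f} hom {□ a φ} (□ a b) s = mk⇔ push pull
    where
    open IsBoundedMorphism hom

    push : Sat M s (□ a φ) → Sat M′ (f s) (□ a φ)
    push h u r with back r
    ... | t , r′ , refl = to (sat-boundedMorphism hom b t) (h t r′)

    pull : Sat M′ (f s) (□ a φ) → Sat M s (□ a φ)
    pull h t r = from (sat-boundedMorphism hom b t) (h (f t) (forth r))

  sat-[/]-cong : ∀ {χ ψ} p → (∀ M s → Sat M s χ ⟺ Sat M s ψ) →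
                 ∀ φ M s → Sat M s (φ [ χ / p ]) ⟺ Sat M s (φ [ ψ / p ])
  sat-[/]-cong p χ⟺ψ (atom q) M s with p ≟ₐ q
  ... | yes _ = χ⟺ψ M s
  ... | no _  = ⇔-id _
  sat-[/]-cong p χ⟺ψ (~ φ)   M s = ¬-cong-⇔ (sat-[/]-cong p χ⟺ψ φ M s)
  sat-[/]-cong p χ⟺ψ (φ ∧ ψ) M s = sat-[/]-cong p χ⟺ψ φ M s ×-⇔ sat-[/]-cong p χ⟺ψ ψ M s
  sat-[/]-cong p χ⟺ψ (□ a φ) M s =
    mk⇔ (λ h t r → to (sat-[/]-cong p χ⟺ψ φ M t) (h t r))
        (λ h t r → from (sat-[/]-cong p χ⟺ψ φ M t) (h t r))
  sat-[/]-cong p χ⟺ψ ([⇉] φ) M s =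
    mk⇔ (λ h M′ s′ sim → to (sat-[/]-cong p χ⟺ψ φ M′ s′) (h M′ s′ sim))
        (λ h M′ s′ sim → from (sat-[/]-cong p χ⟺ψ φ M′ s′) (h M′ s′ sim))

  sat-substPF : ∀ {M s} σ (v : Atom → Bool) → (∀ p → Sat M s (σ p) ⟺ T (v p)) →
                ∀ ψ → Sat M s (substPF σ ψ) ⟺ T (evalPF v ψ)
  sat-substPF σ v σ⟺v (var p)    = σ⟺v p
  sat-substPF σ v σ⟺v (neg ψ)    = ⇔-sym (T-not _) ⇔-∘ ¬-cong-⇔ (sat-substPF σ v σ⟺v ψ)
  sat-substPF σ v σ⟺v (conj ψ χ) = ⇔-sym T-∧ ⇔-∘ (sat-substPF σ v σ⟺v ψ ×-⇔ sat-substPF σ v σ⟺v χ)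

  ⟨⇉⟩Sat-⋁ : ∀ {M s Φ} → Any (⟨⇉⟩Sat M s) Φ → ⟨⇉⟩Sat M s (⋁ Φ)
  ⟨⇉⟩Sat-⋁ any with find any
  ... | _ , φ∈Φ , (M′ , s′ , sim , x) = M′ , s′ , sim , ⋁-intro (lose φ∈Φ x)

  ⟨⇉⟩Sat-⌜⌝ : ∀ {M s} φ₀ → ⟨⇉⟩Sat M s ⌜ φ₀ ⌝ ⟺ Sat M s ⌜ φ₀ ⌝
  ⟨⇉⟩Sat-⌜⌝ φ₀ = mk⇔ (λ (_ , _ , sim , x) → from (sat-⌜⌝-cong (⇉-atoms sim) φ₀) x)
                     (λ x → _ , _ , ⇉-refl , x)

  ⟨⇉⟩Sat-⌜⌝∧ : ∀ {M s} φ₀ φ → ⟨⇉⟩Sat M s (⌜ φ₀ ⌝ ∧ φ) ⟺ (Sat M s ⌜ φ₀ ⌝ × ⟨⇉⟩Sat M s φ)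
  ⟨⇉⟩Sat-⌜⌝∧ φ₀ φ =
    mk⇔ (λ (M′ , s′ , sim , x₀ , x) → from (sat-⌜⌝-cong (⇉-atoms sim) φ₀) x₀ , (M′ , s′ , sim , x))
        (λ (x₀ , (M′ , s′ , sim , x)) → M′ , s′ , sim , to (sat-⌜⌝-cong (⇉-atoms sim) φ₀) x₀ , x)

  module RootedSum {I : Set} (countable-I : Countable I)
                   (piece : I → Model) (root : (i : I) → S (piece i))
                   (Edge : Agent → I → Set) (val : Atom → Bool) where

    Point : Set
    Point = ⊤ ⊎ Σ I (S ∘ piece)

    data Step (a : Agent) : Point → Point → Set where
      enter  : ∀ {i} → Edge a i → Step a (inj₁ tt) (inj₂ (i , root i))
      inside : ∀ {i x y} → R (piece i) a x y → Step a (inj₂ (i , x)) (inj₂ (i , y))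

    label : Point → Atom → Bool
    label (inj₁ _)       = val
    label (inj₂ (i , x)) = V (piece i) x

    countable-Point : Countable Point
    countable-Point = countable-⊎ countable-⊤ (countable-Σ countable-I (countable-S ∘ piece))

    sum : Model
    sum = record
      { S = Point ; s₀ = inj₁ tt
      ; enc = Injection.to countable-Point ; enc-inj = Injection.injective countable-Point
      ; R = Step ; V = label
      }

    embed-isBoundedMorphism : ∀ i → IsBoundedMorphism (piece i) sum (λ x → inj₂ (i , x))
    embed-isBoundedMorphism i = record
      { atoms = λ _ _ → refl ; forth = inside ; back = λ { (inside r) → _ , r , refl } }

    sat-embed : ∀ i {φ} → InLBox φ → ∀ x → Sat (piece i) x φ ⟺ Sat sum (inj₂ (i , x)) φ
    sat-embed i = sat-boundedMorphism (embed-isBoundedMorphism i)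

    module _ {M : Model} {s : S M} (Z : (i : I) → S M → S (piece i) → Set)
             (Z-isSimulation : ∀ i → IsSimulation M (piece i) (Z i))
             (same-atoms : ∀ p → V M s p ≡ val p)
             (covered : ∀ {a t} → R M a s t → Σ I λ i → Edge a i × Z i t (root i)) where

      data Related : S M → Point → Set where
        at-root  : Related s (inj₁ tt)
        in-piece : ∀ {i x y} → Z i x y → Related x (inj₂ (i , y))

      related-isSimulation : IsSimulation M sum Related
      related-isSimulation = record { atoms = atoms ; forth = forth }
        where
        atoms : ∀ x x′ → Related x x′ → ∀ p → V M x p ≡ label x′ p
        atoms _ _ at-root            = same-atoms
        atoms _ _ (in-piece {i} xZy) = IsSimulation.atoms (Z-isSimulation i) _ _ xZy

        forth : ∀ x x′ → Related x x′ →
                ∀ a t → R M a x t → Σ Point λ t′ → Step a x′ t′ × Related t t′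
        forth _ _ at-root a t r with covered r
        ... | i , edge , tZroot = inj₂ (i , root i) , enter edge , in-piece tZroot
        forth _ _ (in-piece {i} xZy) a t r with IsSimulation.forth (Z-isSimulation i) _ _ xZy a t r
        ... | y′ , r′ , tZy′ = inj₂ (i , y′) , inside r′ , in-piece tZy′

      ⇉-sum : M , s ⇉ sum , inj₁ tt
      ⇉-sum = Related , related-isSimulation , at-root

  module _ (em : ExcludedMiddle (lsuc 0ℓ)) where
    private
      dne : ∀ {P : Set₁} → ¬ ¬ P → P
      dne = em⇒dne em

    sat-⇒ : ∀ {M s} φ ψ → Sat M s (φ ⇒ ψ) ⟺ (Sat M s φ → Sat M s ψ)
    sat-⇒ _ _ = mk⇔ (λ h x → dne (λ ¬y → h (x , ¬y))) (λ f (x , ¬y) → ¬y (f x))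

    sat-⇔ : ∀ {M s} φ ψ → Sat M s (φ ⇔ ψ) ⟺ (Sat M s φ ⟺ Sat M s ψ)
    sat-⇔ φ ψ = mk⇔ (λ (φ⇒ψ , ψ⇒φ) → mk⇔ (to (sat-⇒ φ ψ) φ⇒ψ) (to (sat-⇒ ψ φ) ψ⇒φ))
                    (λ φ⟺ψ → from (sat-⇒ φ ψ) (to φ⟺ψ) , from (sat-⇒ ψ φ) (from φ⟺ψ))

    sat-∨ : ∀ {M s} φ ψ → Sat M s (φ ∨ ψ) ⟺ (Sat M s φ ⊎ Sat M s ψ)
    sat-∨ _ _ = mk⇔ (λ h → dne (λ ¬∨ → h (¬∨ ∘ inj₁ , ¬∨ ∘ inj₂)))
                    [ (λ x (¬x , _) → ¬x x) , (λ y (_ , ¬y) → ¬y y) ]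

    sat-⋁ : ∀ {M s} Φ → Sat M s (⋁ Φ) ⟺ Any (Sat M s) Φ
    sat-⋁ {M} {s} [] = mk⇔ (λ h → ⊥-elim (h (sat-⊤f {M} {s}))) (λ ())
    sat-⋁ (φ ∷ Φ)    = mk⇔ (λ h → [ here , there ∘ to (sat-⋁ Φ) ]′ (to (sat-∨ φ (⋁ Φ)) h)) ⋁-intro

    sat-⟨⇉⟩ : ∀ {M s} φ → Sat M s (⟨⇉⟩ φ) ⟺ ⟨⇉⟩Sat M s φ
    sat-⟨⇉⟩ _ = mk⇔ (λ h → dne (λ ∄ → h (λ M′ s′ sim x → ∄ (M′ , s′ , sim , x))))
                    (λ (M′ , s′ , sim , x) □¬ → □¬ M′ s′ sim x)

    ⟨⇉⟩Sat-∨ : ∀ {M s} φ ψ → ⟨⇉⟩Sat M s (φ ∨ ψ) ⟺ (⟨⇉⟩Sat M s φ ⊎ ⟨⇉⟩Sat M s ψ)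
    ⟨⇉⟩Sat-∨ φ ψ =
      mk⇔ (λ (M′ , s′ , sim , x) → Sum.map (λ y → M′ , s′ , sim , y) (λ y → M′ , s′ , sim , y)
                                           (to (sat-∨ φ ψ) x))
          [ (λ (M′ , s′ , sim , y) → M′ , s′ , sim , from (sat-∨ φ ψ) (inj₁ y))
          , (λ (M′ , s′ , sim , y) → M′ , s′ , sim , from (sat-∨ φ ψ) (inj₂ y)) ]

    ⟨⇉⟩Sat-∇-elim : ∀ {M s} (Φ : Agent → List Form) → ⟨⇉⟩Sat M s (⋀A (λ a → ∇ a (Φ a))) →
                    ∀ a → Sat M s (□ a (⋁ (map ⟨⇉⟩ (Φ a))))
    ⟨⇉⟩Sat-∇-elim {M} Φ (M′ , s′ , sim , x) a t r with ⇉-forth sim r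
    ... | t′ , r′ , t⇉t′ = ⋁-intro (Anyₚ.map⁺ (Any.map ⟨⇉⟩-at-t (to (sat-⋁ (Φ a)) ⋁Φa-at-t′)))
      where
      ⋁Φa-at-t′ : Sat M′ t′ (⋁ (Φ a))
      ⋁Φa-at-t′ = proj₂ (to (sat-⋀A (λ a → ∇ a (Φ a))) x a) t′ r′

      ⟨⇉⟩-at-t : ∀ {φ} → Sat M′ t′ φ → Sat M t (⟨⇉⟩ φ)
      ⟨⇉⟩-at-t {φ} y = from (sat-⟨⇉⟩ φ) (M′ , t′ , t⇉t′ , y)

    module _ {M : Model} {s : S M} (Φ : Agent → List Form)
             (Φ-ok : ∀ a → All (λ φ → InLBox φ × Consistent φ) (Φ a))
             (successors : ∀ a → Sat M s (□ a (⋁ (map ⟨⇉⟩ (Φ a))))) where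
      private
        -- Pieces for an agent a are indexed by all states t of M rather than by the
        -- a-successors of s, so that the index set is countable; the piece for t is
        -- entered from the root only when s R_a t.
        Index : Set
        Index = Σ Agent λ a → S M ⊎ Fin (length (Φ a))

        Edge : Agent → Index → Set
        Edge a (b , inj₁ t) = a ≡ b × R M b s t
        Edge a (b , inj₂ k) = a ≡ b

        Spec : Index → (M′ : Model) → S M′ → (S M → S M′ → Set) → Set₁
        Spec (a , inj₁ t) M′ u Z = R M a s t → Z t u × Sat M′ u (⋁ (Φ a))
        Spec (a , inj₂ k) M′ u Z = Sat M′ u (lookup (Φ a) k)

        record Piece (i : Index) : Set₁ where
          field
            model          : Model
            root           : S model
            Z              : S M → S model → Set
            Z-isSimulation : IsSimulation M model Z
            spec           : Spec i model root Z

        successor-⟨⇉⟩Sat : ∀ {a t} → R M a s t → ⟨⇉⟩Sat M t (⋁ (Φ a))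
        successor-⟨⇉⟩Sat {a} r =
          ⟨⇉⟩Sat-⋁ (Any.map (to (sat-⟨⇉⟩ _)) (Anyₚ.map⁻ (to (sat-⋁ _) (successors a _ r))))

        piece : (i : Index) → Piece i
        piece (a , inj₂ k) with proj₂ (All.lookup (Φ-ok a) (∈-lookup k))
        ... | M′ , u , x = record
          { model = M′ ; root = u ; Z = λ _ _ → ⊥ ; Z-isSimulation = ∅-isSimulation ; spec = x }
        piece (a , inj₁ t) with em {Lift (lsuc 0ℓ) (R M a s t)}
        ... | no ¬r = record
          { model = M ; root = t ; Z = λ _ _ → ⊥ ; Z-isSimulation = ∅-isSimulation
          ; spec = λ r → ⊥-elim (¬r (lift r)) }
        ... | yes (lift r) with successor-⟨⇉⟩Sat r
        ... | M′ , u , (Z , Z-isSimulation , tZu) , x = record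
          { model = M′ ; root = u ; Z = Z ; Z-isSimulation = Z-isSimulation ; spec = λ _ → tZu , x }

        open RootedSum
          (countable-Σ countable-Fin λ a → countable-⊎ (countable-S M) countable-Fin)
          (λ i → Piece.model (piece i)) (λ i → Piece.root (piece i)) Edge (V M s)

        covered : ∀ {a t} → R M a s t →
                  Σ Index λ i → Edge a i × Piece.Z (piece i) t (Piece.root (piece i))
        covered {a} {t} r = (a , inj₁ t) , (refl , r) , proj₁ (Piece.spec (piece (a , inj₁ t)) r)

        piece-⋁ : ∀ {a} i → Edge a i → Sat (Piece.model (piece i)) (Piece.root (piece i)) (⋁ (Φ a))
        piece-⋁ (a , inj₁ t) (refl , r) = proj₂ (Piece.spec (piece (a , inj₁ t)) r)
        piece-⋁ (a , inj₂ k) refl       =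
          ⋁-intro (lose (∈-lookup k) (Piece.spec (piece (a , inj₂ k))))

        InLBox-Φ : ∀ a → All InLBox (Φ a)
        InLBox-Φ a = All.map proj₁ (Φ-ok a)

        root-□⋁ : ∀ a → Sat sum (inj₁ tt) (□ a (⋁ (Φ a)))
        root-□⋁ a _ (enter {i} edge) = to (sat-embed i (InLBox-⋁ (InLBox-Φ a)) _) (piece-⋁ i edge)

        root-◇ : ∀ a k → Sat sum (inj₁ tt) (◇ a (lookup (Φ a) k))
        root-◇ a k = ◇-intro (enter refl)
          (to (sat-embed (a , inj₂ k) (All.lookup (InLBox-Φ a) (∈-lookup k)) _)
              (Piece.spec (piece (a , inj₂ k))))

        root-∇ : ∀ a → Sat sum (inj₁ tt) (∇ a (Φ a))
        root-∇ a = from (sat-⋀ _) (Allₚ.map⁺ (All.tabulate λ φ∈Φa →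
                     subst (Sat sum (inj₁ tt) ∘ ◇ a) (sym (Anyₚ.lookup-index φ∈Φa)) (root-◇ a _)))
                 , root-□⋁ a

      ⟨⇉⟩Sat-∇-intro : ⟨⇉⟩Sat M s (⋀A (λ a → ∇ a (Φ a)))
      ⟨⇉⟩Sat-∇-intro =
        sum , inj₁ tt ,
        ⇉-sum (λ i → Piece.Z (piece i)) (λ i → Piece.Z-isSimulation (piece i)) (λ _ → refl) covered ,
        from (sat-⋀A _) root-∇

    sat-⟨⇉⟩⌜⌝ : ∀ {M s} φ₀ → Sat M s (⟨⇉⟩ ⌜ φ₀ ⌝) ⟺ Sat M s ⌜ φ₀ ⌝
    sat-⟨⇉⟩⌜⌝ φ₀ = ⟨⇉⟩Sat-⌜⌝ φ₀ ⇔-∘ sat-⟨⇉⟩ ⌜ φ₀ ⌝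

    sat-⟨⇉⟩∨ : ∀ {M s} φ ψ → Sat M s (⟨⇉⟩ (φ ∨ ψ)) ⟺ Sat M s (⟨⇉⟩ φ ∨ ⟨⇉⟩ ψ)
    sat-⟨⇉⟩∨ {M} {s} φ ψ =
      Sat M s (⟨⇉⟩ (φ ∨ ψ))                ∼⟨ sat-⟨⇉⟩ (φ ∨ ψ) ⟩
      ⟨⇉⟩Sat M s (φ ∨ ψ)                   ∼⟨ ⟨⇉⟩Sat-∨ φ ψ ⟩
      (⟨⇉⟩Sat M s φ ⊎ ⟨⇉⟩Sat M s ψ)        ∼⟨ ⇔-sym (sat-⟨⇉⟩ φ) ⊎-⇔ ⇔-sym (sat-⟨⇉⟩ ψ) ⟩
      (Sat M s (⟨⇉⟩ φ) ⊎ Sat M s (⟨⇉⟩ ψ))  ∼⟨ ⇔-sym (sat-∨ (⟨⇉⟩ φ) (⟨⇉⟩ ψ)) ⟩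
      Sat M s (⟨⇉⟩ φ ∨ ⟨⇉⟩ ψ)              ∎
      where open EquationalReasoning {k = equivalence}

    sat-⟨⇉⟩⌜⌝∧ : ∀ {M s} φ₀ φ → Sat M s (⟨⇉⟩ (⌜ φ₀ ⌝ ∧ φ)) ⟺ Sat M s (⌜ φ₀ ⌝ ∧ ⟨⇉⟩ φ)
    sat-⟨⇉⟩⌜⌝∧ {M} {s} φ₀ φ =
      Sat M s (⟨⇉⟩ (⌜ φ₀ ⌝ ∧ φ))       ∼⟨ sat-⟨⇉⟩ (⌜ φ₀ ⌝ ∧ φ) ⟩
      ⟨⇉⟩Sat M s (⌜ φ₀ ⌝ ∧ φ)          ∼⟨ ⟨⇉⟩Sat-⌜⌝∧ φ₀ φ ⟩
      (Sat M s ⌜ φ₀ ⌝ × ⟨⇉⟩Sat M s φ)  ∼⟨ ⇔-id _ ×-⇔ ⇔-sym (sat-⟨⇉⟩ φ) ⟩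
      Sat M s (⌜ φ₀ ⌝ ∧ ⟨⇉⟩ φ)         ∎
      where open EquationalReasoning {k = equivalence}

    sat-⟨⇉⟩∇ : ∀ {M s} (Φ : Agent → List Form) → (∀ a → All (λ φ → InLBox φ × Consistent φ) (Φ a)) →
               Sat M s (⟨⇉⟩ (⋀A (λ a → ∇ a (Φ a)))) ⟺ Sat M s (⋀A (λ a → □ a (⋁ (map ⟨⇉⟩ (Φ a)))))
    sat-⟨⇉⟩∇ {M} {s} Φ Φ-ok =
      Sat M s (⟨⇉⟩ (⋀A (λ a → ∇ a (Φ a))))
        ∼⟨ sat-⟨⇉⟩ (⋀A (λ a → ∇ a (Φ a))) ⟩
      ⟨⇉⟩Sat M s (⋀A (λ a → ∇ a (Φ a)))
        ∼⟨ mk⇔ (⟨⇉⟩Sat-∇-elim Φ) (⟨⇉⟩Sat-∇-intro Φ Φ-ok) ⟩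
      (∀ a → Sat M s (□ a (⋁ (map ⟨⇉⟩ (Φ a)))))
        ∼⟨ ⇔-sym (sat-⋀A (λ a → □ a (⋁ (map ⟨⇉⟩ (Φ a))))) ⟩
      Sat M s (⋀A (λ a → □ a (⋁ (map ⟨⇉⟩ (Φ a)))))
        ∎
      where open EquationalReasoning {k = equivalence}

    sound : ∀ {φ} → ⊢ φ → Valid φ
    sound (Prop ψ σ taut) M s =
      from (sat-substPF σ v (λ p → mk⇔ fromWitness toWitness) ψ) (from T-≡ (taut v))
      where
      v : Atom → Bool
      v p = isYes (em {Sat M s (σ p)})
    sound (K a φ ψ) M s =
      from (sat-⇒ (□ a (φ ⇒ ψ)) (□ a φ ⇒ □ a ψ)) λ □φ⇒ψ →
      from (sat-⇒ (□ a φ) (□ a ψ)) λ □φ t r → to (sat-⇒ φ ψ) (□φ⇒ψ t r) (□φ t r)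
    sound (MP {φ} {ψ} d e) M s = to (sat-⇒ φ ψ) (sound d M s) (sound e M s)
    sound (N a d) M s t _ = sound d M t
    sound (RE {χ} {ψ} φ p d) M s =
      from (sat-⇔ (φ [ χ / p ]) (φ [ ψ / p ]))
           (sat-[/]-cong p (λ M s → to (sat-⇔ χ ψ) (sound d M s)) φ M s)
    sound (SQ1 φ₀) M s = from (sat-⇔ (⟨⇉⟩ ⌜ φ₀ ⌝) ⌜ φ₀ ⌝) (sat-⟨⇉⟩⌜⌝ φ₀)
    sound (SQ2 φ ψ) M s = from (sat-⇔ (⟨⇉⟩ (φ ∨ ψ)) (⟨⇉⟩ φ ∨ ⟨⇉⟩ ψ)) (sat-⟨⇉⟩∨ φ ψ)
    sound (SQ3 φ₀ φ) M s = from (sat-⇔ (⟨⇉⟩ (⌜ φ₀ ⌝ ∧ φ)) (⌜ φ₀ ⌝ ∧ ⟨⇉⟩ φ)) (sat-⟨⇉⟩⌜⌝∧ φ₀ φ)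
    sound (SQ4cons Φ Φ-ok) M s =
      from (sat-⇔ (⟨⇉⟩ (⋀A (λ a → ∇ a (Φ a)))) (⋀A (λ a → □ a (⋁ (map ⟨⇉⟩ (Φ a))))))
           (sat-⟨⇉⟩∇ Φ Φ-ok)

proposition7 : ExcludedMiddle (lsuc 0ℓ) →
    ∀ (n : ℕ) (Atom : Set) (a₀ : Atom) (code : Atom → ℕ)
      (code-inj : Injective _≡_ _≡_ code) →
    let open Logic n Atom a₀ code code-inj in
    ∀ (φ : Form) → ⊢ φ → Valid φ
proposition7 em n Atom a₀ code code-inj _ = Soundness.sound n Atom a₀ code code-inj em
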